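{- Let $n$ and $r$ be nonnegative integers, let $G$ be an $(n+r+2)$-connected graph, and let $H=G-W-e$ where $W\subseteq V(G)$ with $|W|=n$ and $e\in E(G-W)$. If $X\subseteq V(H)$ satisfies $\mathrm{sun}(H-X)\geq 2|X|+1$, then $|X|\geq r+2$.
   Context: All graphs are finite, undirected and simple. For $X\subseteq V(G)$, $G-X$ deletes the vertices of $X$; $G-e$ deletes edge $e$. A graph $H$ is factor-critical if $H-v$ has a perfect matching for every vertex $v$. A sun is a graph $R$ that is $K_1$, $K_2$, or the corona of a factor-critical graph $H$ with at least three vertices (i.e. $R$ is obtained from $H$ by adding, for each $y\in V(H)$, a new vertex $z(y)$ and the edge $y z(y)$). $\mathrm{sun}(G)$ denotes the number of components of $G$ that are suns. -}

module Defs where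

open import Data.Nat using (ℕ; _<_; _≤_; _+_; _*_)
open import Data.Fin using (Fin)
open import Data.Fin.Subset using (Subset; _∈_; _∉_; _⊆_; ∁; _─_; ∣_∣; ⁅_⁆)
open import Data.Product using (Σ; ∃; _×_; _,_)
open import Data.Sum using (_⊎_)
open import Relation.Binary.PropositionalEquality using (_≡_)
open import Relation.Nullary using (¬_)

record Graph (N : ℕ) : Set₁ where
  field
    adj    : Fin N → Fin N → Set
    sym    : ∀ {x y} → adj x y → adj y x
    irrefl : ∀ {x} → ¬ adj x x
open Graph public

-- Throughout, a "graph" on a vertex set U ⊆ Fin N with edge relation A means
-- the graph with vertices U and edges {x,y} with x,y ∈ U and A x y
-- (i.e. A restricted to U).

data Reach {N : ℕ} (U : Subset N) (A : Fin N → Fin N → Set) (x : Fin N) : Fin N → Set where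
  here : x ∈ U → Reach U A x x
  step : ∀ {y z} → Reach U A x y → z ∈ U → A y z → Reach U A x z

Connected : {N : ℕ} → Subset N → (Fin N → Fin N → Set) → Set
Connected U A = ∀ x y → x ∈ U → y ∈ U → Reach U A x y

KConnected : {N : ℕ} → ℕ → Graph N → Set
KConnected {N} k G = (k < N) × (∀ (S : Subset N) → ∣ S ∣ < k → Connected (∁ S) (adj G))

delEdge : {N : ℕ} → (Fin N → Fin N → Set) → Fin N → Fin N → (Fin N → Fin N → Set)
delEdge A u v x y = A x y × ¬ (x ≡ u × y ≡ v) × ¬ (x ≡ v × y ≡ u)

IsComponent : {N : ℕ} → Subset N → (Fin N → Fin N → Set) → Subset N → Set
IsComponent U A C =
  (∃ λ x → x ∈ C) × C ⊆ U × Connected C A ×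
  (∀ {x y} → x ∈ C → y ∈ U → A x y → y ∈ C)

HasPerfectMatching : {N : ℕ} → Subset N → (Fin N → Fin N → Set) → Set
HasPerfectMatching {N} S A =
  Σ (Fin N → Fin N) λ m → ∀ x → x ∈ S → (m x ∈ S) × A x (m x) × (m (m x) ≡ x)

FactorCritical : {N : ℕ} → Subset N → (Fin N → Fin N → Set) → Set
FactorCritical D A = ∀ v → v ∈ D → HasPerfectMatching (D ─ ⁅ v ⁆) A

-- The graph (C, A) is isomorphic to the corona of a factor-critical graph
-- with at least three vertices: D ⊆ C induces the factor-critical graph H,
-- z : D → C ∖ D is a bijection, z y is adjacent to y and to no other vertex of C.
IsCorona : {N : ℕ} → Subset N → (Fin N → Fin N → Set) → Set
IsCorona {N} C A =
  Σ (Subset N) λ D → Σ (Fin N → Fin N) λ z →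
    D ⊆ C × 3 ≤ ∣ D ∣ × FactorCritical D A ×
    (∀ y → y ∈ D → z y ∈ C × z y ∉ D × A y (z y) ×
                   (∀ w → w ∈ C → A (z y) w → w ≡ y)) ×
    (∀ y y′ → y ∈ D → y′ ∈ D → z y ≡ z y′ → y ≡ y′) ×
    (∀ w → w ∈ C → w ∉ D → ∃ λ y → y ∈ D × z y ≡ w)

-- The graph (C, A) (assumed connected) is a sun: K₁, K₂, or a corona as above.
IsSun : {N : ℕ} → Subset N → (Fin N → Fin N → Set) → Set
IsSun C A = (∣ C ∣ ≡ 1) ⊎ ((∣ C ∣ ≡ 2) × Connected C A) ⊎ IsCorona C A

SunAtLeast : {N : ℕ} → ℕ → Subset N → (Fin N → Fin N → Set) → Set
SunAtLeast {N} k U A =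
  Σ (Fin k → Subset N) λ Cs →
    (∀ i → IsComponent U A (Cs i) × IsSun (Cs i) A) ×
    (∀ i j → Cs i ≡ Cs j → i ≡ j)

{-# OPTIONS --safe #-}
-- If |X| ≤ r + 1 then G − W − X is connected, since |W ∪ X| < n + r + 2.
-- Deleting the single edge e = uv from a connected graph leaves at most two
-- components, so sun(H − X) ≤ 2 < 2|X| + 1 as soon as X ≠ ∅.  For X = ∅,
-- G − W is 2-connected on at least three vertices: a vertex t whose only
-- neighbour in its component of H is y still has a neighbour ≠ y in G − W
-- (on a path to a third vertex avoiding y), so t is an endpoint of e.  Hence
-- no component of H is K₁ (every vertex has an H-neighbour), K₂ (both of its
-- vertices would be the endpoints of e) or a corona (its at least three
-- pendant vertices would all be endpoints of e).
module Submission where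

open import Defs
import Data.Nat as ℕ
open import Data.Nat using (ℕ; zero; suc; _≤_; _<_; _+_; _*_; z≤n; s≤s)
open import Data.Nat.Properties
  using (<-irrefl; ≤-trans; ≤-<-trans; ≤-reflexive; n≤1+n; +-suc; +-comm; +-assoc; +-cancelʳ-≤; +-monoˡ-≤;
         +-monoʳ-<; *-monoʳ-≤; m≤n+m; n≢0⇒n>0; m+n≤o⇒m≤o∸n; ≮⇒≥; module ≤-Reasoning)
open import Data.Fin using (Fin; zero; suc; _≟_; inject≤)
open import Data.Fin.Properties using (inject≤-injective)
open import Data.Fin.Subset using (Subset; _∈_; _∉_; _⊆_; ∁; _─_; _-_; _∪_; ∣_∣; ⁅_⁆; Nonempty) renaming (⊥ to ∅)
open import Data.Fin.Subset.Properties
  using (∣⁅x⁆∣≡1; ∣∁p∣≡n∸∣p∣; p─⊥≡p; p─q⊆p; x∉⁅y⁆⇒x≢y; x∈p∧x≢y⇒x∈p-y; x∈p⇒∣p-x∣<∣p∣; ⊆-antisym)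
open import Data.Vec using (_∷_; []; here; there)
open import Data.Bool using (true; false)
open import Data.Product using (∃; _×_; _,_; proj₁; proj₂)
open import Data.Sum using (_⊎_; inj₁; inj₂)
open import Data.Empty using (⊥-elim)
open import Function using (_∘_; case_of_)
open import Relation.Nullary using (¬_; yes; no; _×-dec_)
open import Relation.Binary.PropositionalEquality as ≡ using (_≡_; _≢_; refl; cong; subst)

private
  variable
    N k : ℕ
    p : Subset N
    A : Fin N → Fin N → Set
    U C C′ C₀ C₁ C₂ : Subset N
    u v a b c x y : Fin N

∣p∪q∣≤∣p∣+∣q∣ : (p q : Subset N) → ∣ p ∪ q ∣ ≤ ∣ p ∣ + ∣ q ∣
∣p∪q∣≤∣p∣+∣q∣ []          []          = z≤n
∣p∪q∣≤∣p∣+∣q∣ (true ∷ p)  (true ∷ q)  =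
  s≤s (≤-trans (∣p∪q∣≤∣p∣+∣q∣ p q) (≤-trans (n≤1+n _) (≤-reflexive (≡.sym (+-suc ∣ p ∣ ∣ q ∣)))))
∣p∪q∣≤∣p∣+∣q∣ (true ∷ p)  (false ∷ q) = s≤s (∣p∪q∣≤∣p∣+∣q∣ p q)
∣p∪q∣≤∣p∣+∣q∣ (false ∷ p) (true ∷ q)  =
  ≤-trans (s≤s (∣p∪q∣≤∣p∣+∣q∣ p q)) (≤-reflexive (≡.sym (+-suc ∣ p ∣ ∣ q ∣)))
∣p∪q∣≤∣p∣+∣q∣ (false ∷ p) (false ∷ q) = ∣p∪q∣≤∣p∣+∣q∣ p q

∣p∣≤∣p─q∣+∣q∣ : (p q : Subset N) → ∣ p ∣ ≤ ∣ p ─ q ∣ + ∣ q ∣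
∣p∣≤∣p─q∣+∣q∣ []          []          = z≤n
∣p∣≤∣p─q∣+∣q∣ (true ∷ p)  (true ∷ q)  =
  ≤-trans (s≤s (∣p∣≤∣p─q∣+∣q∣ p q)) (≤-reflexive (≡.sym (+-suc ∣ p ─ q ∣ ∣ q ∣)))
∣p∣≤∣p─q∣+∣q∣ (true ∷ p)  (false ∷ q) = s≤s (∣p∣≤∣p─q∣+∣q∣ p q)
∣p∣≤∣p─q∣+∣q∣ (false ∷ p) (true ∷ q)  =
  ≤-trans (∣p∣≤∣p─q∣+∣q∣ p q) (≤-trans (n≤1+n _) (≤-reflexive (≡.sym (+-suc ∣ p ─ q ∣ ∣ q ∣))))
∣p∣≤∣p─q∣+∣q∣ (false ∷ p) (false ∷ q) = ∣p∣≤∣p─q∣+∣q∣ p q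

∣p∣≤∣p-x∣+1 : (p : Subset N) (x : Fin N) → ∣ p ∣ ≤ ∣ p - x ∣ + 1
∣p∣≤∣p-x∣+1 p x = subst (λ m → ∣ p ∣ ≤ ∣ p - x ∣ + m) (∣⁅x⁆∣≡1 x) (∣p∣≤∣p─q∣+∣q∣ p ⁅ x ⁆)

∁p─q≡∁[p∪q] : (p q : Subset N) → ∁ p ─ q ≡ ∁ (p ∪ q)
∁p─q≡∁[p∪q] []          []          = refl
∁p─q≡∁[p∪q] (true ∷ p)  (true ∷ q)  = cong (false ∷_) (∁p─q≡∁[p∪q] p q)
∁p─q≡∁[p∪q] (true ∷ p)  (false ∷ q) = cong (false ∷_) (∁p─q≡∁[p∪q] p q)
∁p─q≡∁[p∪q] (false ∷ p) (true ∷ q)  = cong (false ∷_) (∁p─q≡∁[p∪q] p q)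
∁p─q≡∁[p∪q] (false ∷ p) (false ∷ q) = cong (true ∷_) (∁p─q≡∁[p∪q] p q)

∣p∣≡0⇒p≡∅ : ∣ p ∣ ≡ 0 → p ≡ ∅
∣p∣≡0⇒p≡∅ {p = []}        _  = refl
∣p∣≡0⇒p≡∅ {p = false ∷ p} eq = cong (false ∷_) (∣p∣≡0⇒p≡∅ eq)

x∈p─q⇒x∉q : (p q : Subset N) → x ∈ p ─ q → x ∉ q
x∈p─q⇒x∉q (true ∷ p) (false ∷ q) here       ()
x∈p─q⇒x∉q (_ ∷ p)    (_ ∷ q)     (there x∈) (there x∈q) = x∈p─q⇒x∉q p q x∈ x∈q

x∈p-y⇒x≢y : x ∈ p - y → x ≢ y
x∈p-y⇒x≢y {p = p} {y = y} x∈ = x∉⁅y⁆⇒x≢y (x∈p─q⇒x∉q p ⁅ y ⁆ x∈)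

1≤∣p∣⇒nonempty : (p : Subset N) → 1 ≤ ∣ p ∣ → Nonempty p
1≤∣p∣⇒nonempty (true ∷ p)  _  = zero , here
1≤∣p∣⇒nonempty (false ∷ p) le with 1≤∣p∣⇒nonempty p le
... | x , x∈p = suc x , there x∈p

x∈p⇒1≤∣p∣ : x ∈ p → 1 ≤ ∣ p ∣
x∈p⇒1≤∣p∣ x∈p = ≤-<-trans z≤n (x∈p⇒∣p-x∣<∣p∣ x∈p)

x,y∈p⇒2≤∣p∣ : x ∈ p → y ∈ p → x ≢ y → 2 ≤ ∣ p ∣
x,y∈p⇒2≤∣p∣ x∈p y∈p x≢y = ≤-<-trans (x∈p⇒1≤∣p∣ (x∈p∧x≢y⇒x∈p-y y∈p (x≢y ∘ ≡.sym))) (x∈p⇒∣p-x∣<∣p∣ x∈p)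

x,y,z∈p⇒3≤∣p∣ : a ∈ p → b ∈ p → c ∈ p → a ≢ b → a ≢ c → b ≢ c → 3 ≤ ∣ p ∣
x,y,z∈p⇒3≤∣p∣ a∈p b∈p c∈p a≢b a≢c b≢c =
  ≤-<-trans (x,y∈p⇒2≤∣p∣ (x∈p∧x≢y⇒x∈p-y b∈p (a≢b ∘ ≡.sym)) (x∈p∧x≢y⇒x∈p-y c∈p (a≢c ∘ ≡.sym)) b≢c)
            (x∈p⇒∣p-x∣<∣p∣ a∈p)

3≤∣p∣⇒∃≢ : 3 ≤ ∣ p ∣ → (a b : Fin N) → ∃ λ s → s ∈ p × s ≢ a × s ≢ b
3≤∣p∣⇒∃≢ {p = p} 3≤∣p∣ a b with 1≤∣p∣⇒nonempty (p - a - b) 1≤∣p-a-b∣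
  where
  open ≤-Reasoning
  1≤∣p-a-b∣ : 1 ≤ ∣ p - a - b ∣
  1≤∣p-a-b∣ = +-cancelʳ-≤ 2 1 _ (begin
    3                       ≤⟨ 3≤∣p∣ ⟩
    ∣ p ∣                   ≤⟨ ∣p∣≤∣p-x∣+1 p a ⟩
    ∣ p - a ∣ + 1           ≤⟨ +-monoˡ-≤ 1 (∣p∣≤∣p-x∣+1 (p - a) b) ⟩
    ∣ p - a - b ∣ + 1 + 1   ≡⟨ +-assoc ∣ p - a - b ∣ 1 1 ⟩
    ∣ p - a - b ∣ + 2       ∎)
... | s , s∈ = s , p─q⊆p p ⁅ a ⁆ (p─q⊆p (p - a) ⁅ b ⁆ s∈) ,
                x∈p-y⇒x≢y (p─q⊆p (p - a) ⁅ b ⁆ s∈) , x∈p-y⇒x≢y s∈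

3≤∣p∣⇒three-elements : 3 ≤ ∣ p ∣ → ∃ λ a → ∃ λ b → ∃ λ c → a ∈ p × b ∈ p × c ∈ p × a ≢ b × a ≢ c × b ≢ c
3≤∣p∣⇒three-elements {p = p} 3≤∣p∣ with 1≤∣p∣⇒nonempty p (≤-trans (s≤s z≤n) 3≤∣p∣)
... | a , a∈p with 3≤∣p∣⇒∃≢ 3≤∣p∣ a a
... | b , b∈p , b≢a , _ with 3≤∣p∣⇒∃≢ 3≤∣p∣ a b
... | c , c∈p , c≢a , c≢b = a , b , c , a∈p , b∈p , c∈p , b≢a ∘ ≡.sym , c≢a ∘ ≡.sym , c≢b ∘ ≡.sym

Reach-⊆ : {S T : Subset N} → S ⊆ T → Reach S A x y → Reach T A x y
Reach-⊆ S⊆T (here x∈S)      = here (S⊆T x∈S)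
Reach-⊆ S⊆T (step r z∈S yz) = step (Reach-⊆ S⊆T r) (S⊆T z∈S) yz

Reach-head : Reach U A x y → x ≡ y ⊎ ∃ λ w → w ∈ U × A x w
Reach-head (here _) = inj₁ refl
Reach-head (step r z∈U yz) with Reach-head r
... | inj₁ refl = inj₂ (_ , z∈U , yz)
... | inj₂ head = inj₂ head

Reach-cons : x ∈ U → A x y → Reach U A y a → Reach U A x a
Reach-cons x∈U xy (here y∈U)      = step (here x∈U) y∈U xy
Reach-cons x∈U xy (step r z∈U yz) = step (Reach-cons x∈U xy r) z∈U yz

Reach-sym : (∀ {x y} → A x y → A y x) → Reach U A x y → Reach U A y x
Reach-sym A-sym (here x∈U)      = here x∈U
Reach-sym A-sym (step r z∈U yz) = Reach-cons z∈U (A-sym yz) (Reach-sym A-sym r)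

IsComponent-closed : IsComponent U A C → x ∈ C → Reach U A x y → y ∈ C
IsComponent-closed K x∈C (here _) = x∈C
IsComponent-closed K@(_ , _ , _ , closed) x∈C (step r z∈U yz) = closed (IsComponent-closed K x∈C r) z∈U yz

IsComponent-≡ : IsComponent U A C → IsComponent U A C′ → x ∈ C → x ∈ C′ → C ≡ C′
IsComponent-≡ K K′ x∈C x∈C′ = ⊆-antisym (⊆-component K K′ x∈C x∈C′) (⊆-component K′ K x∈C′ x∈C)
  where
  ⊆-component : IsComponent U A C → IsComponent U A C′ → x ∈ C → x ∈ C′ → C ⊆ C′
  ⊆-component (_ , C⊆U , C-conn , _) K′ x∈C x∈C′ y∈C =
    IsComponent-closed K′ x∈C′ (Reach-⊆ C⊆U (C-conn _ _ x∈C y∈C))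

delEdge-sym : (G : Graph N) → delEdge (adj G) u v x y → delEdge (adj G) u v y x
delEdge-sym G (xy , ¬uv , ¬vu) =
  sym G xy , (λ (y≡u , x≡v) → ¬vu (x≡v , y≡u)) , (λ (y≡v , x≡u) → ¬uv (x≡u , y≡v))

delEdge⊎deleted : A x y → delEdge A u v x y ⊎ (x ≡ u × y ≡ v) ⊎ (x ≡ v × y ≡ u)
delEdge⊎deleted {x = x} {y = y} {u = u} {v = v} xy with x ≟ u ×-dec y ≟ v | x ≟ v ×-dec y ≟ u
... | yes uv | _      = inj₂ (inj₁ uv)
... | no _   | yes vu = inj₂ (inj₂ vu)
... | no ¬uv | no ¬vu = inj₁ (xy , ¬uv , ¬vu)

¬delEdge-within-pair : a ≡ u ⊎ a ≡ v → b ≡ u ⊎ b ≡ v → a ≢ b → ¬ delEdge A u v a b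
¬delEdge-within-pair (inj₁ refl) (inj₁ refl) a≢b _               = a≢b refl
¬delEdge-within-pair (inj₂ refl) (inj₂ refl) a≢b _               = a≢b refl
¬delEdge-within-pair (inj₁ refl) (inj₂ refl) _   (_ , ¬uv , _)   = ¬uv (refl , refl)
¬delEdge-within-pair (inj₂ refl) (inj₁ refl) _   (_ , _ , ¬vu)   = ¬vu (refl , refl)

pair-pigeonhole : a ≡ u ⊎ a ≡ v → b ≡ u ⊎ b ≡ v → c ≡ u ⊎ c ≡ v → a ≡ b ⊎ a ≡ c ⊎ b ≡ c
pair-pigeonhole (inj₁ refl) (inj₁ refl) _           = inj₁ refl
pair-pigeonhole (inj₂ refl) (inj₂ refl) _           = inj₁ refl
pair-pigeonhole (inj₁ refl) (inj₂ refl) (inj₁ refl) = inj₂ (inj₁ refl)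
pair-pigeonhole (inj₁ refl) (inj₂ refl) (inj₂ refl) = inj₂ (inj₂ refl)
pair-pigeonhole (inj₂ refl) (inj₁ refl) (inj₁ refl) = inj₂ (inj₂ refl)
pair-pigeonhole (inj₂ refl) (inj₁ refl) (inj₂ refl) = inj₂ (inj₁ refl)

module _ {A : Fin N → Fin N → Set} {u v : Fin N} where

  private
    H : Fin N → Fin N → Set
    H = delEdge A u v

  Reach-delEdge : Reach U A x y →
    Reach U H x y ⊎ (Reach U H x u × Reach U H v y) ⊎ (Reach U H x v × Reach U H u y)
  Reach-delEdge (here x∈U) = inj₁ (here x∈U)
  Reach-delEdge (step r z∈U yz) with Reach-delEdge r | delEdge⊎deleted {A = A} {u = u} {v = v} yz
  ... | inj₁ R                  | inj₁ yz′                = inj₁ (step R z∈U yz′)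
  ... | inj₂ (inj₁ (R₁ , R₂))   | inj₁ yz′                = inj₂ (inj₁ (R₁ , step R₂ z∈U yz′))
  ... | inj₂ (inj₂ (R₁ , R₂))   | inj₁ yz′                = inj₂ (inj₂ (R₁ , step R₂ z∈U yz′))
  ... | inj₁ R                  | inj₂ (inj₁ (refl , refl)) = inj₂ (inj₁ (R , here z∈U))
  ... | inj₁ R                  | inj₂ (inj₂ (refl , refl)) = inj₂ (inj₂ (R , here z∈U))
  ... | inj₂ (inj₁ (R₁ , _))    | inj₂ (inj₁ (refl , refl)) = inj₂ (inj₁ (R₁ , here z∈U))
  ... | inj₂ (inj₁ (R₁ , _))    | inj₂ (inj₂ (refl , refl)) = inj₁ R₁
  ... | inj₂ (inj₂ (R₁ , _))    | inj₂ (inj₁ (refl , refl)) = inj₁ R₁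
  ... | inj₂ (inj₂ (R₁ , _))    | inj₂ (inj₂ (refl , refl)) = inj₂ (inj₂ (R₁ , here z∈U))

module _ (G : Graph N) {u v : Fin N} where

  private
    H : Fin N → Fin N → Set
    H = delEdge (adj G) u v

  components-of-delEdge : Connected U (adj G) → IsComponent U H C → IsComponent U H C′ →
                          C ≡ C′ ⊎ (u ∈ C × v ∈ C′) ⊎ (v ∈ C × u ∈ C′)
  components-of-delEdge U-conn K@((x , x∈C) , C⊆U , _) K′@((x′ , x′∈C′) , C′⊆U , _)
    with Reach-delEdge (U-conn x x′ (C⊆U x∈C) (C′⊆U x′∈C′))
  ... | inj₁ R = inj₁ (IsComponent-≡ K K′ (IsComponent-closed K x∈C R) x′∈C′)
  ... | inj₂ (inj₁ (R₁ , R₂)) =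
    inj₂ (inj₁ (IsComponent-closed K x∈C R₁ , IsComponent-closed K′ x′∈C′ (Reach-sym (delEdge-sym G) R₂)))
  ... | inj₂ (inj₂ (R₁ , R₂)) =
    inj₂ (inj₂ (IsComponent-closed K x∈C R₁ , IsComponent-closed K′ x′∈C′ (Reach-sym (delEdge-sym G) R₂)))

  three-components-of-delEdge : Connected U (adj G) →
    IsComponent U H C₀ → IsComponent U H C₁ → IsComponent U H C₂ → C₀ ≡ C₁ ⊎ C₀ ≡ C₂ ⊎ C₁ ≡ C₂
  three-components-of-delEdge U-conn K₀ K₁ K₂
    with components-of-delEdge U-conn K₁ K₀ | components-of-delEdge U-conn K₂ K₀
  ... | inj₁ C₁≡C₀                | _                             = inj₁ (≡.sym C₁≡C₀)
  ... | _                         | inj₁ C₂≡C₀                    = inj₂ (inj₁ (≡.sym C₂≡C₀))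
  ... | inj₂ (inj₁ (u∈C₁ , _))    | inj₂ (inj₁ (u∈C₂ , _))        = inj₂ (inj₂ (IsComponent-≡ K₁ K₂ u∈C₁ u∈C₂))
  ... | inj₂ (inj₂ (v∈C₁ , _))    | inj₂ (inj₂ (v∈C₂ , _))        = inj₂ (inj₂ (IsComponent-≡ K₁ K₂ v∈C₁ v∈C₂))
  ... | inj₂ (inj₁ (u∈C₁ , _))    | inj₂ (inj₂ (_ , u∈C₀))        = inj₁ (IsComponent-≡ K₀ K₁ u∈C₀ u∈C₁)
  ... | inj₂ (inj₂ (v∈C₁ , _))    | inj₂ (inj₁ (_ , v∈C₀))        = inj₁ (IsComponent-≡ K₀ K₁ v∈C₀ v∈C₁)

module TwoConnectedMinusEdge (G : Graph N) {U : Subset N} (3≤∣U∣ : 3 ≤ ∣ U ∣)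
         (U-y-connected : ∀ y → Connected (U - y) (adj G)) {u v : Fin N} (uv : adj G u v) where

  private
    H : Fin N → Fin N → Set
    H = delEdge (adj G) u v

    adj-irrefl : adj G x y → x ≢ y
    adj-irrefl xy refl = irrefl G xy

  neighbour-avoiding : x ∈ U → x ≢ y → ∃ λ w → adj G x w × w ∈ U × w ≢ y
  neighbour-avoiding {x} {y} x∈U x≢y with 3≤∣p∣⇒∃≢ 3≤∣U∣ x y
  ... | s , s∈U , s≢x , s≢y
    with Reach-head (U-y-connected y x s (x∈p∧x≢y⇒x∈p-y x∈U x≢y) (x∈p∧x≢y⇒x∈p-y s∈U s≢y))
  ... | inj₁ x≡s                 = ⊥-elim (s≢x (≡.sym x≡s))
  ... | inj₂ (w , w∈U-y , xw)    = w , xw , p─q⊆p U ⁅ y ⁆ w∈U-y , x∈p-y⇒x≢y w∈U-y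

  H-neighbour : x ∈ U → ∃ λ w → H x w × w ∈ U
  H-neighbour {x} x∈U with x ≟ u
  ... | yes refl with neighbour-avoiding x∈U (adj-irrefl uv)
  ...   | w , xw , w∈U , w≢v = w , (xw , (λ (_ , w≡v) → w≢v w≡v) , (λ (x≡v , _) → adj-irrefl uv x≡v)) , w∈U
  H-neighbour {x} x∈U | no x≢u with neighbour-avoiding x∈U x≢u
  ...   | w , xw , w∈U , w≢u = w , (xw , (λ (x≡u , _) → x≢u x≡u) , (λ (_ , w≡u) → w≢u w≡u)) , w∈U

  pendant⇒endpoint : IsComponent U H C → x ∈ C → x ≢ y → (∀ w → w ∈ C → H x w → w ≡ y) → x ≡ u ⊎ x ≡ v
  pendant⇒endpoint K@(_ , C⊆U , _ , closed) x∈C x≢y pendant with neighbour-avoiding (C⊆U x∈C) x≢y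
  ... | w , xw , w∈U , w≢y with delEdge⊎deleted {A = adj G} {u = u} {v = v} xw
  ...   | inj₁ xw′                = ⊥-elim (w≢y (pendant w (closed x∈C w∈U xw′) xw′))
  ...   | inj₂ (inj₁ (x≡u , _))   = inj₁ x≡u
  ...   | inj₂ (inj₂ (x≡v , _))   = inj₂ x≡v

  component-≢K₁ : IsComponent U H C → ∣ C ∣ ≢ 1
  component-≢K₁ ((x , x∈C) , C⊆U , _ , closed) ∣C∣≡1 with H-neighbour (C⊆U x∈C)
  ... | y , xy , y∈U =
    <-irrefl refl (subst (2 ≤_) ∣C∣≡1 (x,y∈p⇒2≤∣p∣ x∈C (closed x∈C y∈U xy) (adj-irrefl (proj₁ xy))))

  component-≢K₂ : IsComponent U H C → ∣ C ∣ ≢ 2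
  component-≢K₂ {C = C} K@((x , x∈C) , C⊆U , _ , closed) ∣C∣≡2 with H-neighbour (C⊆U x∈C)
  ... | y , xy , y∈U =
    ¬delEdge-within-pair {A = adj G} (endpoint x∈C y∈C x≢y) (endpoint y∈C x∈C (x≢y ∘ ≡.sym)) x≢y xy
    where
    y∈C : y ∈ C
    y∈C = closed x∈C y∈U xy
    x≢y : x ≢ y
    x≢y = adj-irrefl (proj₁ xy)
    only-other : a ∈ C → b ∈ C → a ≢ b → ∀ w → w ∈ C → H a w → w ≡ b
    only-other {b = b} a∈C b∈C a≢b w w∈C aw with w ≟ b
    ... | yes w≡b = w≡b
    ... | no  w≢b = ⊥-elim (<-irrefl refl (subst (3 ≤_) ∣C∣≡2
                      (x,y,z∈p⇒3≤∣p∣ a∈C b∈C w∈C a≢b (adj-irrefl (proj₁ aw)) (w≢b ∘ ≡.sym))))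
    endpoint : a ∈ C → b ∈ C → a ≢ b → a ≡ u ⊎ a ≡ v
    endpoint a∈C b∈C a≢b = pendant⇒endpoint K a∈C a≢b (only-other a∈C b∈C a≢b)

  component-¬corona : IsComponent U H C → ¬ IsCorona C H
  component-¬corona K (D , z , _ , 3≤∣D∣ , _ , pendant , z-injective , _) =
    let (a , b , c , a∈D , b∈D , c∈D , a≢b , a≢c , b≢c) = 3≤∣p∣⇒three-elements 3≤∣D∣ in
    case pair-pigeonhole (z-endpoint a∈D) (z-endpoint b∈D) (z-endpoint c∈D) of λ where
      (inj₁ za≡zb)        → a≢b (z-injective a b a∈D b∈D za≡zb)
      (inj₂ (inj₁ za≡zc)) → a≢c (z-injective a c a∈D c∈D za≡zc)
      (inj₂ (inj₂ zb≡zc)) → b≢c (z-injective b c b∈D c∈D zb≡zc)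
    where
    z-endpoint : y ∈ D → z y ≡ u ⊎ z y ≡ v
    z-endpoint {y} y∈D = let (zy∈C , zy∉D , _ , zy-pendant) = pendant y y∈D in
      pendant⇒endpoint K zy∈C (λ zy≡y → zy∉D (subst (_∈ D) (≡.sym zy≡y) y∈D)) zy-pendant

  component-¬sun : IsComponent U H C → ¬ IsSun C H
  component-¬sun K (inj₁ ∣C∣≡1)              = component-≢K₁ K ∣C∣≡1
  component-¬sun K (inj₂ (inj₁ (∣C∣≡2 , _))) = component-≢K₂ K ∣C∣≡2
  component-¬sun K (inj₂ (inj₂ corona))      = component-¬corona K corona

SunAtLeast-mono : {j k : ℕ} → j ≤ k → SunAtLeast k U A → SunAtLeast j U A
SunAtLeast-mono j≤k (Cs , sun , Cs-injective) =
  (λ i → Cs (inject≤ i j≤k)) , (λ i → sun (inject≤ i j≤k)) ,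
  (λ i i′ eq → inject≤-injective j≤k j≤k i i′ (Cs-injective _ _ eq))

KConnected⇒Connected-∁─ : (G : Graph N) → KConnected k G → (S T : Subset N) → ∣ S ∣ + ∣ T ∣ < k →
                          Connected (∁ S ─ T) (adj G)
KConnected⇒Connected-∁─ G (_ , G-conn) S T ∣S∣+∣T∣<k rewrite ∁p─q≡∁[p∪q] S T =
  G-conn (S ∪ T) (≤-<-trans (∣p∪q∣≤∣p∣+∣q∣ S T) ∣S∣+∣T∣<k)

KConnected⇒¬SunAtLeast-1 : (G : Graph N) → KConnected k G → (W : Subset N) → ∣ W ∣ + 1 < k →
                           adj G u v → ¬ SunAtLeast 1 (∁ W) (delEdge (adj G) u v)
KConnected⇒¬SunAtLeast-1 {N = N} G G-conn@(k<N , _) W ∣W∣+1<k uv (_ , sun , _) =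
  TwoConnectedMinusEdge.component-¬sun G 3≤∣∁W∣ ∁W-y-connected uv (proj₁ (sun zero)) (proj₂ (sun zero))
  where
  3≤∣∁W∣ : 3 ≤ ∣ ∁ W ∣
  3≤∣∁W∣ = subst (3 ≤_) (≡.sym (∣∁p∣≡n∸∣p∣ W))
             (m+n≤o⇒m≤o∸n 3 (subst (λ m → 2 + m ≤ N) (+-comm ∣ W ∣ 1) (≤-trans (s≤s ∣W∣+1<k) k<N)))
  ∁W-y-connected : ∀ y → Connected (∁ W - y) (adj G)
  ∁W-y-connected y = KConnected⇒Connected-∁─ G G-conn W ⁅ y ⁆
                       (subst (λ m → ∣ W ∣ + m < _) (≡.sym (∣⁅x⁆∣≡1 y)) ∣W∣+1<k)

Connected⇒¬SunAtLeast-3 : (G : Graph N) → Connected U (adj G) → ¬ SunAtLeast 3 U (delEdge (adj G) u v)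
Connected⇒¬SunAtLeast-3 G U-conn (Cs , sun , Cs-injective)
  with three-components-of-delEdge G U-conn
         (proj₁ (sun zero)) (proj₁ (sun (suc zero))) (proj₁ (sun (suc (suc zero))))
... | inj₁ C₀≡C₁        = case Cs-injective zero (suc zero) C₀≡C₁ of λ ()
... | inj₂ (inj₁ C₀≡C₂) = case Cs-injective zero (suc (suc zero)) C₀≡C₂ of λ ()
... | inj₂ (inj₂ C₁≡C₂) = case Cs-injective (suc zero) (suc (suc zero)) C₁≡C₂ of λ ()

¬SunAtLeast-2∣X∣+1 : (G : Graph N) → KConnected k G → (W X : Subset N) → adj G u v →
                     ∣ W ∣ + 1 < k → ∣ W ∣ + ∣ X ∣ < k →
                     ¬ SunAtLeast (2 * ∣ X ∣ + 1) (∁ W ─ X) (delEdge (adj G) u v)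
¬SunAtLeast-2∣X∣+1 G G-conn W X uv ∣W∣+1<k ∣W∣+∣X∣<k suns with ∣ X ∣ ℕ.≟ 0
... | yes ∣X∣≡0 = KConnected⇒¬SunAtLeast-1 G G-conn W ∣W∣+1<k uv
                    (subst (λ U → SunAtLeast 1 U _) ∁W─X≡∁W (SunAtLeast-mono (m≤n+m 1 _) suns))
  where
  ∁W─X≡∁W : ∁ W ─ X ≡ ∁ W
  ∁W─X≡∁W = ≡.trans (cong (∁ W ─_) (∣p∣≡0⇒p≡∅ ∣X∣≡0)) (p─⊥≡p (∁ W))
... | no ∣X∣≢0 = Connected⇒¬SunAtLeast-3 G (KConnected⇒Connected-∁─ G G-conn W X ∣W∣+∣X∣<k)
                   (SunAtLeast-mono (+-monoˡ-≤ 1 (*-monoʳ-≤ 2 (n≢0⇒n>0 ∣X∣≢0))) suns)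

lemma1 : ∀ {N : ℕ} (n r : ℕ) (G : Graph N) → KConnected (n + r + 2) G →
         (W : Subset N) → ∣ W ∣ ≡ n →
         (u v : Fin N) → u ∉ W → v ∉ W → adj G u v →
         (X : Subset N) → X ⊆ ∁ W →
         SunAtLeast (2 * ∣ X ∣ + 1) (∁ W ─ X) (delEdge (adj G) u v) →
         r + 2 ≤ ∣ X ∣
lemma1 _ r G G-conn W refl u v _ _ uv X _ suns =
  ≮⇒≥ λ ∣X∣<r+2 → ¬SunAtLeast-2∣X∣+1 G G-conn W X uv (shift (m≤n+m 2 r)) (shift ∣X∣<r+2) suns
  where
  shift : ∀ {m} → m < r + 2 → ∣ W ∣ + m < ∣ W ∣ + r + 2
  shift {m} m<r+2 = subst (∣ W ∣ + m <_) (≡.sym (+-assoc ∣ W ∣ r 2)) (+-monoʳ-< ∣ W ∣ m<r+2)
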